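{- Let $\phi$ be a formula, $\xi,\eta$ models, and $k,m\in\omega$ with $m>0$, such that: (1) ${\rm Sub}(\phi,\langle k,0\rangle,\xi)={\rm Sub}(\phi,\langle k+m,0\rangle,\xi)$; (2) $\xi(\mathbf t,p)=\eta(\mathbf t,p)$ for all $\mathbf t<\langle k+m,0\rangle$ and all $p\in Var$; (3) $\eta(\mathbf s,p)=\eta(s_1+m,s_2,p)$ for all $\mathbf s\geqslant\langle k,0\rangle$ and all $p\in Var$; (4) if $\psi\,\mathtt U\,\theta\in{\rm Sub}(\phi)$ and $\xi\models_{\langle k,0\rangle}\psi\,\mathtt U\,\theta$, then there exists $\mathbf r$ with $\langle k,0\rangle\leqslant\mathbf r<\langle k+m,0\rangle$ and $\xi\models_{\mathbf r}\theta$. Then (a) ${\rm Sub}(\phi,\mathbf t,\xi)={\rm Sub}(\phi,\mathbf t,\eta)$ for all $\mathbf t<\langle k+m,0\rangle$; and (b) ${\rm Sub}(\phi,\mathbf s,\eta)={\rm Sub}(\phi,\langle s_1+m,s_2\rangle,\eta)$ for all $\mathbf s\geqslant\langle k,0\rangle$.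
   Context: Let $Var=\{p_n : n\in\omega\}$. Formulas are built from $Var$ using unary $\lnot$, $[1]$, $[\omega]$ and binary $\land$, $\mathtt u$, $\mathtt U$. Time instants are pairs $\mathbf t=\langle t_1,t_2\rangle\in\omega\times\omega$, ordered lexicographically ($\langle i,j\rangle\leqslant\langle k,l\rangle$ iff $i<k$, or $i=k$ and $j\leqslant l$). A model is a function $\xi:\omega\times\omega\times Var\to\{0,1\}$ (we write $\xi(\mathbf t,p)$ for $\xi(t_1,t_2,p)$). Satisfaction: $\xi\models_{\mathbf r}p$ iff $\xi(\mathbf r,p)=1$; $\lnot,\land$ classically; $\xi\models_{\mathbf r}[1]\phi$ iff $\xi\models_{\langle r_1,r_2+1\rangle}\phi$; $\xi\models_{\mathbf r}[\omega]\phi$ iff $\xi\models_{\langle r_1+1,0\rangle}\phi$; $\xi\models_{\mathbf r}\phi\,\mathtt u\,\psi$ iff there is $k\in\omega$ with $\xi\models_{\langle r_1,r_2+k\rangle}\psi$ and $\xi\models_{\langle r_1,r_2+i\rangle}\phi$ for all $0\leqslant i<k$; $\xi\models_{\mathbf r}\phi\,\mathtt U\,\psi$ iff there is $\mathbf s\geqslant\mathbf r$ with $\xi\models_{\mathbf s}\psi$ and $\xi\models_{\mathbf t}\phi$ for all $\mathbf r\leqslant\mathbf t<\mathbf s$. ${\rm Sub}(\phi)$ is the set of subformulas of $\phi$, and ${\rm Sub}(\phi,\mathbf t,\xi)=\{\psi\in{\rm Sub}(\phi) : \xi\models_{\mathbf t}\psi\}$. -}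

module Defs where

open import Data.Nat using (ℕ; zero; suc; _+_; _<_; _≤_)
open import Data.Product using (Σ; _×_; _,_; ∃-syntax)
open import Data.Sum using (_⊎_)
open import Relation.Nullary using (¬_)
open import Relation.Binary.PropositionalEquality using (_≡_)
open import Function.Bundles using (_⇔_)
open import Data.Bool using (Bool; true)

data Form : Set where
  var  : ℕ → Form
  ¬'   : Form → Form
  [1]  : Form → Form
  [ω]  : Form → Form
  _∧'_ : Form → Form → Form
  _u_  : Form → Form → Form
  _U_  : Form → Form → Form

Time : Set
Time = ℕ × ℕ

_≤ₜ_ : Time → Time → Set
(i , j) ≤ₜ (k , l) = (i < k) ⊎ ((i ≡ k) × (j ≤ l))

_<ₜ_ : Time → Time → Set
s <ₜ t = (s ≤ₜ t) × ¬ (s ≡ t)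

-- Models ξ : ω × ω × Var → {0,1}  (Var identified with ℕ via p_n ↦ n)
Model : Set
Model = ℕ → ℕ → ℕ → Bool

_⊨[_]_ : Model → Time → Form → Set
ξ ⊨[ (r₁ , r₂) ] var n = ξ r₁ r₂ n ≡ true
ξ ⊨[ r ] ¬' φ = ¬ (ξ ⊨[ r ] φ)
ξ ⊨[ (r₁ , r₂) ] [1] φ = ξ ⊨[ (r₁ , suc r₂) ] φ
ξ ⊨[ (r₁ , r₂) ] [ω] φ = ξ ⊨[ (suc r₁ , 0) ] φ
ξ ⊨[ r ] (φ ∧' ψ) = (ξ ⊨[ r ] φ) × (ξ ⊨[ r ] ψ)
ξ ⊨[ (r₁ , r₂) ] (φ u ψ) =
  ∃[ k ] ((ξ ⊨[ (r₁ , r₂ + k) ] ψ) × (∀ i → i < k → ξ ⊨[ (r₁ , r₂ + i) ] φ))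
ξ ⊨[ r ] (φ U ψ) =
  ∃[ s ] ((r ≤ₜ s) × (ξ ⊨[ s ] ψ) × (∀ t → r ≤ₜ t → t <ₜ s → ξ ⊨[ t ] φ))

data _∈Sub_ : Form → Form → Set where
  here : ∀ {φ} → φ ∈Sub φ
  ¬'-in : ∀ {ψ φ} → ψ ∈Sub φ → ψ ∈Sub (¬' φ)
  [1]-in : ∀ {ψ φ} → ψ ∈Sub φ → ψ ∈Sub ([1] φ)
  [ω]-in : ∀ {ψ φ} → ψ ∈Sub φ → ψ ∈Sub ([ω] φ)
  ∧ˡ : ∀ {ψ φ χ} → ψ ∈Sub φ → ψ ∈Sub (φ ∧' χ)
  ∧ʳ : ∀ {ψ φ χ} → ψ ∈Sub χ → ψ ∈Sub (φ ∧' χ)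
  uˡ : ∀ {ψ φ χ} → ψ ∈Sub φ → ψ ∈Sub (φ u χ)
  uʳ : ∀ {ψ φ χ} → ψ ∈Sub χ → ψ ∈Sub (φ u χ)
  Uˡ : ∀ {ψ φ χ} → ψ ∈Sub φ → ψ ∈Sub (φ U χ)
  Uʳ : ∀ {ψ φ χ} → ψ ∈Sub χ → ψ ∈Sub (φ U χ)

-- Sub(φ, t, ξ) = Sub(φ, s, η), as equality of subsets of Sub(φ)
SubEq : Form → Time → Model → Time → Model → Set
SubEq φ t ξ s η = ∀ ψ → ψ ∈Sub φ → (ξ ⊨[ t ] ψ) ⇔ (η ⊨[ s ] ψ)

-- Part (b) is an induction on formulas: every operator except U only looks along a row or at
-- the start of the next one, and translation by m rows is an order isomorphism of the instants
-- from ⟨k,0⟩ on, so it carries U-witnesses to U-witnesses.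
--
-- For part (a) induct on the subformulas of φ at instants below ⟨k+m,0⟩, where ξ and η have
-- the same valuation. Only [ω] and U reach the boundary ⟨k+m,0⟩, and they depend on what lies
-- beyond it only through their own truth value there. At the boundary ξ repeats ⟨k,0⟩ by (1)
-- and η does by (b), so it suffices that ξ and η agree at ⟨k,0⟩. For [ω] χ this is the
-- induction hypothesis for χ; for ψ U θ both models fulfil it inside the first period — ξ by (4),
-- η because a later witness moved back by m is still a witness — and there they agree.

module Submission where

open import Defs
open import Data.Nat using (ℕ; suc; _+_; _∸_; _<_; _≤_; z≤n; _<?_)
open import Data.Nat.Properties
  using (≤-refl; ≤-trans; <-trans; <⇒≤; <-irrefl; <-≤-trans; <-cmp; ≮⇒≥;
         m≤n⇒m<n∨m≡n; m≤n⇒m≤1+n; m≤m+n; m≤n+m; m<m+n; m∸n+n≡m;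
         +-monoˡ-<; +-cancelʳ-<; +-cancelʳ-≡)
open import Data.Nat.Induction using (<-rec)
open import Data.Product using (_×_; _,_; ∃-syntax)
open import Data.Product.Function.NonDependent.Propositional using (_×-⇔_)
open import Data.Sum using (_⊎_; inj₁; inj₂)
open import Data.Empty using (⊥-elim)
open import Function using (id; _∘_)
open import Function.Bundles using (_⇔_; mk⇔; Equivalence)
open import Function.Construct.Symmetry using (⇔-sym)
open import Function.Related.TypeIsomorphisms using (¬-cong-⇔)
open import Function.Related.Propositional using (module EquationalReasoning; equivalence)
open import Relation.Binary.Definitions using (tri<; tri≈; tri>)
open import Relation.Binary.PropositionalEquality using (_≡_; refl; sym; trans; cong; subst)
open import Relation.Nullary using (¬_; yes; no)

open Equivalence using (to; from)

infix 4 _<ₗ_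

_<ₗ_ : Time → Time → Set
(a , b) <ₗ (c , d) = (a < c) ⊎ ((a ≡ c) × (b < d))

≤ₜ-refl : ∀ {s} → s ≤ₜ s
≤ₜ-refl = inj₂ (refl , ≤-refl)

≤ₜ-trans : ∀ {r s t} → r ≤ₜ s → s ≤ₜ t → r ≤ₜ t
≤ₜ-trans (inj₁ a<c)          (inj₁ c<e)          = inj₁ (<-trans a<c c<e)
≤ₜ-trans (inj₁ a<c)          (inj₂ (refl , _))   = inj₁ a<c
≤ₜ-trans (inj₂ (refl , _))   (inj₁ c<e)          = inj₁ c<e
≤ₜ-trans (inj₂ (refl , b≤d)) (inj₂ (refl , d≤f)) = inj₂ (refl , ≤-trans b≤d d≤f)

<ₗ⇒≤ₜ : ∀ {s t} → s <ₗ t → s ≤ₜ t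
<ₗ⇒≤ₜ (inj₁ a<c)          = inj₁ a<c
<ₗ⇒≤ₜ (inj₂ (a≡c , b<d)) = inj₂ (a≡c , <⇒≤ b<d)

<ₗ-≤ₜ-trans : ∀ {r s t} → r <ₗ s → s ≤ₜ t → r <ₗ t
<ₗ-≤ₜ-trans (inj₁ a<c)          (inj₁ c<e)          = inj₁ (<-trans a<c c<e)
<ₗ-≤ₜ-trans (inj₁ a<c)          (inj₂ (refl , _))   = inj₁ a<c
<ₗ-≤ₜ-trans (inj₂ (refl , _))   (inj₁ c<e)          = inj₁ c<e
<ₗ-≤ₜ-trans (inj₂ (refl , b<d)) (inj₂ (refl , d≤f)) = inj₂ (refl , <-≤-trans b<d d≤f)

<ₗ-trans : ∀ {r s t} → r <ₗ s → s <ₗ t → r <ₗ t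
<ₗ-trans r<s s<t = <ₗ-≤ₜ-trans r<s (<ₗ⇒≤ₜ s<t)

<ₗ-irrefl : ∀ {s} → ¬ s <ₗ s
<ₗ-irrefl (inj₁ a<a)       = <-irrefl refl a<a
<ₗ-irrefl (inj₂ (_ , b<b)) = <-irrefl refl b<b

<ₗ⇒<ₜ : ∀ {s t} → s <ₗ t → s <ₜ t
<ₗ⇒<ₜ s<t = <ₗ⇒≤ₜ s<t , λ { refl → <ₗ-irrefl s<t }

<ₜ⇒<ₗ : ∀ {s t} → s <ₜ t → s <ₗ t
<ₜ⇒<ₗ (inj₁ a<c , _)          = inj₁ a<c
<ₜ⇒<ₗ (inj₂ (refl , b≤d) , s≢t) with m≤n⇒m<n∨m≡n b≤d
... | inj₁ b<d  = inj₂ (refl , b<d)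
... | inj₂ refl = ⊥-elim (s≢t refl)

<ₗ-or-≥ₜ : ∀ s t → s <ₗ t ⊎ t ≤ₜ s
<ₗ-or-≥ₜ (a , b) (c , d) with <-cmp a c
... | tri< a<c _ _ = inj₁ (inj₁ a<c)
... | tri> _ _ c<a = inj₂ (inj₁ c<a)
... | tri≈ _ refl _ with b <? d
...   | yes b<d = inj₁ (inj₂ (refl , b<d))
...   | no  b≮d = inj₂ (inj₂ (refl , ≮⇒≥ b≮d))

<ₗ-rowStart⇒< : ∀ {a b c} → (a , b) <ₗ (c , 0) → a < c
<ₗ-rowStart⇒< (inj₁ a<c) = a<c

≤ₜ⇒≤ : ∀ {a b c d} → (a , b) ≤ₜ (c , d) → a ≤ c
≤ₜ⇒≤ (inj₁ a<c)        = <⇒≤ a<c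
≤ₜ⇒≤ (inj₂ (refl , _)) = ≤-refl

≤⇒rowStart≤ₜ : ∀ {a c d} → a ≤ c → (a , 0) ≤ₜ (c , d)
≤⇒rowStart≤ₜ a≤c with m≤n⇒m<n∨m≡n a≤c
... | inj₁ a<c  = inj₁ a<c
... | inj₂ refl = inj₂ (refl , z≤n)

shift : ℕ → Time → Time
shift m (a , b) = (a + m , b)

module _ (m : ℕ) where

  shift-mono-≤ₜ : ∀ {s t} → s ≤ₜ t → shift m s ≤ₜ shift m t
  shift-mono-≤ₜ (inj₁ a<c)          = inj₁ (+-monoˡ-< m a<c)
  shift-mono-≤ₜ (inj₂ (refl , b≤d)) = inj₂ (refl , b≤d)

  shift-mono-<ₗ : ∀ {s t} → s <ₗ t → shift m s <ₗ shift m t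
  shift-mono-<ₗ (inj₁ a<c)          = inj₁ (+-monoˡ-< m a<c)
  shift-mono-<ₗ (inj₂ (refl , b<d)) = inj₂ (refl , b<d)

  shift-cancel-≤ₜ : ∀ {s t} → shift m s ≤ₜ shift m t → s ≤ₜ t
  shift-cancel-≤ₜ {a , _} {c , _} (inj₁ a+m<c+m)    = inj₁ (+-cancelʳ-< m a c a+m<c+m)
  shift-cancel-≤ₜ {a , _} {c , _} (inj₂ (eq , b≤d)) = inj₂ (+-cancelʳ-≡ m a c eq , b≤d)

  shift-cancel-<ₗ : ∀ {s t} → shift m s <ₗ shift m t → s <ₗ t
  shift-cancel-<ₗ {a , _} {c , _} (inj₁ a+m<c+m)    = inj₁ (+-cancelʳ-< m a c a+m<c+m)
  shift-cancel-<ₗ {a , _} {c , _} (inj₂ (eq , b<d)) = inj₂ (+-cancelʳ-≡ m a c eq , b<d)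

  unshift : ∀ {s} t → shift m s ≤ₜ t → ∃[ v ] ((shift m v ≡ t) × (s ≤ₜ v))
  unshift {a , _} (c , d) s+m≤t =
    (c ∸ m , d) , c∸m+m≡c , shift-cancel-≤ₜ (subst (_ ≤ₜ_) (sym c∸m+m≡c) s+m≤t)
    where
    c∸m+m≡c : shift m (c ∸ m , d) ≡ (c , d)
    c∸m+m≡c = cong (_, d) (m∸n+n≡m (≤-trans (m≤n+m m a) (≤ₜ⇒≤ s+m≤t)))

HoldsOn : Model → Form → Time → Time → Set
HoldsOn ζ α r e = ∀ t → r ≤ₜ t → t <ₗ e → ζ ⊨[ t ] α

UntilBefore : Model → Form → Form → Time → Time → Set
UntilBefore ζ α β r e = ∃[ w ] ((r ≤ₜ w) × (w <ₗ e) × (ζ ⊨[ w ] β) × HoldsOn ζ α r w)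

module _ (ζ : Model) (α β : Form) where

  holdsOn-mono : ∀ {r r′ e e′} → r ≤ₜ r′ → e′ ≤ₜ e → HoldsOn ζ α r e → HoldsOn ζ α r′ e′
  holdsOn-mono r≤r′ e′≤e αs t r′≤t t<e′ = αs t (≤ₜ-trans r≤r′ r′≤t) (<ₗ-≤ₜ-trans t<e′ e′≤e)

  holdsOn-join : ∀ {r e s} → HoldsOn ζ α r e → HoldsOn ζ α e s → HoldsOn ζ α r s
  holdsOn-join {e = e} αre αes t r≤t t<s with <ₗ-or-≥ₜ t e
  ... | inj₁ t<e = αre t r≤t t<e
  ... | inj₂ e≤t = αes t e≤t t<s

  until-intro : ∀ {r s} → r ≤ₜ s → ζ ⊨[ s ] β → HoldsOn ζ α r s → ζ ⊨[ r ] (α U β)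
  until-intro r≤s βs αs = _ , r≤s , βs , λ t r≤t t<s → αs t r≤t (<ₜ⇒<ₗ t<s)

  until-elim : ∀ {r} → ζ ⊨[ r ] (α U β) → ∃[ s ] ((r ≤ₜ s) × (ζ ⊨[ s ] β) × HoldsOn ζ α r s)
  until-elim (s , r≤s , βs , αs) = s , r≤s , βs , λ t r≤t t<s → αs t r≤t (<ₗ⇒<ₜ t<s)

  untilBefore⇒until : ∀ {r e} → UntilBefore ζ α β r e → ζ ⊨[ r ] (α U β)
  untilBefore⇒until (_ , r≤w , _ , βw , αs) = until-intro r≤w βw αs

  until-split : ∀ {r e} → r ≤ₜ e → ζ ⊨[ r ] (α U β) →
                UntilBefore ζ α β r e ⊎ (HoldsOn ζ α r e × ζ ⊨[ e ] (α U β))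
  until-split {e = e} r≤e αUβ with until-elim αUβ
  ... | s , r≤s , βs , αs with <ₗ-or-≥ₜ s e
  ...   | inj₁ s<e = inj₁ (s , r≤s , s<e , βs , αs)
  ...   | inj₂ e≤s =
    inj₂ (holdsOn-mono ≤ₜ-refl e≤s αs , until-intro e≤s βs (holdsOn-mono r≤e ≤ₜ-refl αs))

  until-join : ∀ {r e} → r ≤ₜ e → HoldsOn ζ α r e → ζ ⊨[ e ] (α U β) → ζ ⊨[ r ] (α U β)
  until-join r≤e αre αUβ with until-elim αUβ
  ... | s , e≤s , βs , αes = until-intro (≤ₜ-trans r≤e e≤s) βs (holdsOn-join αre αes)

  until⇒untilBefore : ∀ {r w e} → ζ ⊨[ r ] (α U β) → r ≤ₜ w → w <ₗ e → ζ ⊨[ w ] β →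
                      UntilBefore ζ α β r e
  until⇒untilBefore αUβ r≤w w<e βw with until-split r≤w αUβ
  ... | inj₁ (v , r≤v , v<w , βv , αs) = v , r≤v , <ₗ-trans v<w w<e , βv , αs
  ... | inj₂ (αs , _)                   = _ , r≤w , w<e , βw , αs

record RowEquiv (R : ℕ → Set) (f : ℕ → ℕ) (ζ ζ′ : Model) (χ : Form) : Set where
  field
    at : ∀ a b → R a → (ζ ⊨[ (a , b) ] χ) ⇔ (ζ′ ⊨[ (f a , b) ] χ)

open RowEquiv

module _ {R : ℕ → Set} {f : ℕ → ℕ} {ζ ζ′ : Model} where

  ¬-rowEquiv : ∀ {χ} → RowEquiv R f ζ ζ′ χ → RowEquiv R f ζ ζ′ (¬' χ)
  at (¬-rowEquiv equiv) a b Ra = ¬-cong-⇔ (at equiv a b Ra)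

  [1]-rowEquiv : ∀ {χ} → RowEquiv R f ζ ζ′ χ → RowEquiv R f ζ ζ′ ([1] χ)
  at ([1]-rowEquiv equiv) a b = at equiv a (suc b)

  ∧-rowEquiv : ∀ {α β} → RowEquiv R f ζ ζ′ α → RowEquiv R f ζ ζ′ β → RowEquiv R f ζ ζ′ (α ∧' β)
  at (∧-rowEquiv equivα equivβ) a b Ra = at equivα a b Ra ×-⇔ at equivβ a b Ra

  u-rowEquiv : ∀ {α β} → RowEquiv R f ζ ζ′ α → RowEquiv R f ζ ζ′ β → RowEquiv R f ζ ζ′ (α u β)
  at (u-rowEquiv equivα equivβ) a b Ra = mk⇔
    (λ (j , βj , αs) → j , to (at equivβ a (b + j) Ra) βj ,
                       λ i i<j → to (at equivα a (b + i) Ra) (αs i i<j))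
    (λ (j , βj , αs) → j , from (at equivβ a (b + j) Ra) βj ,
                       λ i i<j → from (at equivα a (b + i) Ra) (αs i i<j))

rowEquiv-sym : ∀ {R ζ ζ′ χ} → RowEquiv R id ζ ζ′ χ → RowEquiv R id ζ′ ζ χ
at (rowEquiv-sym equiv) a b Ra = ⇔-sym (at equiv a b Ra)

at-below : ∀ {c ζ ζ′ χ t} → RowEquiv (_< c) id ζ ζ′ χ → t <ₗ (c , 0) → (ζ ⊨[ t ] χ) ⇔ (ζ′ ⊨[ t ] χ)
at-below {t = a , b} equiv ab<c = at equiv a b (<ₗ-rowStart⇒< ab<c)

module _ (ξ η : Model) {c : ℕ} (α β : Form)
         (agreeα : RowEquiv (_< c) id ξ η α) (agreeβ : RowEquiv (_< c) id ξ η β) where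

  holdsOn-transfer : ∀ {r w} → w ≤ₜ (c , 0) → HoldsOn ξ α r w → HoldsOn η α r w
  holdsOn-transfer w≤c αs t r≤t t<w = to (at-below agreeα (<ₗ-≤ₜ-trans t<w w≤c)) (αs t r≤t t<w)

  untilBefore-transfer : ∀ {r} → UntilBefore ξ α β r (c , 0) → UntilBefore η α β r (c , 0)
  untilBefore-transfer (w , r≤w , w<c , βw , αs) =
    w , r≤w , w<c , to (at-below agreeβ w<c) βw , holdsOn-transfer (<ₗ⇒≤ₜ w<c) αs

  until-transfer : ∀ {r} → r ≤ₜ (c , 0) → (ξ ⊨[ (c , 0) ] (α U β) → η ⊨[ (c , 0) ] (α U β)) →
                   ξ ⊨[ r ] (α U β) → η ⊨[ r ] (α U β)
  until-transfer r≤c atC αUβ with until-split ξ α β r≤c αUβ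
  ... | inj₁ before      = untilBefore⇒until η α β (untilBefore-transfer before)
  ... | inj₂ (αs , αUβc) = until-join η α β r≤c (holdsOn-transfer ≤ₜ-refl αs) (atC αUβc)

module _ {k m : ℕ} {ζ ζ′ : Model} {α β : Form}
         (equivα : RowEquiv (k ≤_) (_+ m) ζ ζ′ α) (equivβ : RowEquiv (k ≤_) (_+ m) ζ ζ′ β) where

  U-rowEquiv-shift : RowEquiv (k ≤_) (_+ m) ζ ζ′ (α U β)
  at U-rowEquiv-shift a b k≤a = mk⇔ forth back
    where
    k≤row : ∀ {c d} → (a , b) ≤ₜ (c , d) → k ≤ c
    k≤row ab≤cd = ≤-trans k≤a (≤ₜ⇒≤ ab≤cd)

    forth : ζ ⊨[ (a , b) ] (α U β) → ζ′ ⊨[ (a + m , b) ] (α U β)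
    forth αUβ with until-elim ζ α β αUβ
    ... | (c , d) , ab≤cd , βcd , αs =
      until-intro ζ′ α β (shift-mono-≤ₜ m ab≤cd) (to (at equivβ c d (k≤row ab≤cd)) βcd) αs′
      where
      αs′ : HoldsOn ζ′ α (a + m , b) (c + m , d)
      αs′ t ab+m≤t t<cd+m with unshift m t ab+m≤t
      ... | (e , f) , refl , ab≤ef =
        to (at equivα e f (k≤row ab≤ef)) (αs (e , f) ab≤ef (shift-cancel-<ₗ m t<cd+m))

    back : ζ′ ⊨[ (a + m , b) ] (α U β) → ζ ⊨[ (a , b) ] (α U β)
    back αUβ with until-elim ζ′ α β αUβ
    ... | s , ab+m≤s , βs , αs with unshift m s ab+m≤s
    ...   | (c , d) , refl , ab≤cd =
      until-intro ζ α β ab≤cd (from (at equivβ c d (k≤row ab≤cd)) βs) αs′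
      where
      αs′ : HoldsOn ζ α (a , b) (c , d)
      αs′ (e , f) ab≤ef ef<cd =
        from (at equivα e f (k≤row ab≤ef)) (αs (e + m , f) (shift-mono-≤ₜ m ab≤ef) (shift-mono-<ₗ m ef<cd))

Periodic : Model → ℕ → ℕ → Set
Periodic η k m = ∀ a b p → k ≤ a → η a b p ≡ η (a + m) b p

periodic-rowEquiv : ∀ {η k m} → Periodic η k m → ∀ χ → RowEquiv (k ≤_) (_+ m) η η χ
at (periodic-rowEquiv per (var p)) a b k≤a = mk⇔ (trans (sym (per a b p k≤a))) (trans (per a b p k≤a))
periodic-rowEquiv per (¬' χ)    = ¬-rowEquiv (periodic-rowEquiv per χ)
periodic-rowEquiv per ([1] χ)   = [1]-rowEquiv (periodic-rowEquiv per χ)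
at (periodic-rowEquiv per ([ω] χ)) a _ k≤a = at (periodic-rowEquiv per χ) (suc a) 0 (m≤n⇒m≤1+n k≤a)
periodic-rowEquiv per (α ∧' β)  = ∧-rowEquiv (periodic-rowEquiv per α) (periodic-rowEquiv per β)
periodic-rowEquiv per (α u β)   = u-rowEquiv (periodic-rowEquiv per α) (periodic-rowEquiv per β)
periodic-rowEquiv per (α U β)   = U-rowEquiv-shift (periodic-rowEquiv per α) (periodic-rowEquiv per β)

module _ {ζ : Model} {k m : ℕ} {α β : Form} (0<m : 0 < m)
         (equivα : RowEquiv (k ≤_) (_+ m) ζ ζ α) (equivβ : RowEquiv (k ≤_) (_+ m) ζ ζ β) where

  until⇒untilBefore-period : ζ ⊨[ (k , 0) ] (α U β) → UntilBefore ζ α β (k , 0) (k + m , 0)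
  until⇒untilBefore-period αUβ with until-elim ζ α β αUβ
  ... | (c , d) , k≤cd , βcd , αs = <-rec Descent descend c d k≤cd βcd αs
    where
    Descent : ℕ → Set
    Descent c = ∀ d → (k , 0) ≤ₜ (c , d) → ζ ⊨[ (c , d) ] β → HoldsOn ζ α (k , 0) (c , d) →
                UntilBefore ζ α β (k , 0) (k + m , 0)

    descend : ∀ c → (∀ {c′} → c′ < c → Descent c′) → Descent c
    descend c rec d k≤cd βcd αs with c <? k + m
    ... | yes c<k+m = (c , d) , k≤cd , inj₁ c<k+m , βcd , αs
    ... | no  c≮k+m with unshift m (c , d) (≤⇒rowStart≤ₜ (≮⇒≥ c≮k+m))
    ...   | (c′ , d′) , refl , k≤c′d′ =
      rec (m<m+n c′ 0<m) d′ k≤c′d′ (from (at equivβ c′ d′ (≤ₜ⇒≤ k≤c′d′)) βcd) αs′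
      where
      αs′ : HoldsOn ζ α (k , 0) (c′ , d′)
      αs′ (e , f) k≤ef ef<c′d′ =
        from (at equivα e f (≤ₜ⇒≤ k≤ef))
             (αs (e + m , f) (≤⇒rowStart≤ₜ (≤-trans (≤ₜ⇒≤ k≤ef) (m≤m+n e m))) (shift-mono-<ₗ m ef<c′d′))

_⊆Sub_ : Form → Form → Set
χ ⊆Sub φ = ∀ {ψ} → ψ ∈Sub χ → ψ ∈Sub φ

∈Sub⇒⊆Sub : ∀ {χ φ} → χ ∈Sub φ → χ ⊆Sub φ
∈Sub⇒⊆Sub here           ψ∈χ = ψ∈χ
∈Sub⇒⊆Sub (¬'-in χ∈φ)    ψ∈χ = ¬'-in (∈Sub⇒⊆Sub χ∈φ ψ∈χ)
∈Sub⇒⊆Sub ([1]-in χ∈φ)   ψ∈χ = [1]-in (∈Sub⇒⊆Sub χ∈φ ψ∈χ)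
∈Sub⇒⊆Sub ([ω]-in χ∈φ)   ψ∈χ = [ω]-in (∈Sub⇒⊆Sub χ∈φ ψ∈χ)
∈Sub⇒⊆Sub (∧ˡ χ∈φ)       ψ∈χ = ∧ˡ (∈Sub⇒⊆Sub χ∈φ ψ∈χ)
∈Sub⇒⊆Sub (∧ʳ χ∈φ)       ψ∈χ = ∧ʳ (∈Sub⇒⊆Sub χ∈φ ψ∈χ)
∈Sub⇒⊆Sub (uˡ χ∈φ)       ψ∈χ = uˡ (∈Sub⇒⊆Sub χ∈φ ψ∈χ)
∈Sub⇒⊆Sub (uʳ χ∈φ)       ψ∈χ = uʳ (∈Sub⇒⊆Sub χ∈φ ψ∈χ)
∈Sub⇒⊆Sub (Uˡ χ∈φ)       ψ∈χ = Uˡ (∈Sub⇒⊆Sub χ∈φ ψ∈χ)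
∈Sub⇒⊆Sub (Uʳ χ∈φ)       ψ∈χ = Uʳ (∈Sub⇒⊆Sub χ∈φ ψ∈χ)

module Agreement (φ : Form) (ξ η : Model) (k m : ℕ) (0<m : 0 < m)
  (recurs : SubEq φ (k , 0) ξ (k + m , 0) ξ)
  (agree : ∀ a b p → a < k + m → ξ a b p ≡ η a b p)
  (per : Periodic η k m)
  (witnessed : ∀ α β → (α U β) ∈Sub φ → ξ ⊨[ (k , 0) ] (α U β) →
               ∃[ r ] (((k , 0) ≤ₜ r) × (r <ₜ (k + m , 0)) × (ξ ⊨[ r ] β)))
  where

  start boundary : Time
  start    = (k , 0)
  boundary = (k + m , 0)

  η-periodic : ∀ χ → RowEquiv (k ≤_) (_+ m) η η χ
  η-periodic = periodic-rowEquiv per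

  agree-at-boundary : ∀ {χ} → χ ∈Sub φ → (ξ ⊨[ start ] χ) ⇔ (η ⊨[ start ] χ) →
                      (ξ ⊨[ boundary ] χ) ⇔ (η ⊨[ boundary ] χ)
  agree-at-boundary {χ} χ∈φ agreeStart = begin
    ξ ⊨[ boundary ] χ ∼⟨ ⇔-sym (recurs χ χ∈φ) ⟩
    ξ ⊨[ start ] χ    ∼⟨ agreeStart ⟩
    η ⊨[ start ] χ    ∼⟨ at (η-periodic χ) k 0 ≤-refl ⟩
    η ⊨[ boundary ] χ ∎
    where open EquationalReasoning

  module _ {α β : Form} (αUβ∈φ : (α U β) ∈Sub φ)
           (agreeα : RowEquiv (_< k + m) id ξ η α) (agreeβ : RowEquiv (_< k + m) id ξ η β) where

    until-agree-at-start : (ξ ⊨[ start ] (α U β)) ⇔ (η ⊨[ start ] (α U β))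
    until-agree-at-start = mk⇔ forth back
      where
      forth : ξ ⊨[ start ] (α U β) → η ⊨[ start ] (α U β)
      forth αUβ with witnessed α β αUβ∈φ αUβ
      ... | r , start≤r , r<boundary , βr =
        untilBefore⇒until η α β (untilBefore-transfer ξ η α β agreeα agreeβ
          (until⇒untilBefore ξ α β αUβ start≤r (<ₜ⇒<ₗ r<boundary) βr))

      back : η ⊨[ start ] (α U β) → ξ ⊨[ start ] (α U β)
      back αUβ =
        untilBefore⇒until ξ α β (untilBefore-transfer η ξ α β (rowEquiv-sym agreeα) (rowEquiv-sym agreeβ)
          (until⇒untilBefore-period 0<m (η-periodic α) (η-periodic β) αUβ))

    until-rowEquiv : RowEquiv (_< k + m) id ξ η (α U β)
    at until-rowEquiv a b a<k+m = mk⇔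
      (until-transfer ξ η α β agreeα agreeβ (inj₁ a<k+m) (to atBoundary))
      (until-transfer η ξ α β (rowEquiv-sym agreeα) (rowEquiv-sym agreeβ) (inj₁ a<k+m) (from atBoundary))
      where
      atBoundary : (ξ ⊨[ boundary ] (α U β)) ⇔ (η ⊨[ boundary ] (α U β))
      atBoundary = agree-at-boundary αUβ∈φ until-agree-at-start

  agree-before-boundary : ∀ χ → χ ⊆Sub φ → RowEquiv (_< k + m) id ξ η χ
  at (agree-before-boundary (var p) _) a b a<k+m =
    mk⇔ (trans (sym (agree a b p a<k+m))) (trans (agree a b p a<k+m))
  agree-before-boundary (¬' χ)   χ⊆φ = ¬-rowEquiv (agree-before-boundary χ (χ⊆φ ∘ ¬'-in))
  agree-before-boundary ([1] χ)  χ⊆φ = [1]-rowEquiv (agree-before-boundary χ (χ⊆φ ∘ [1]-in))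
  at (agree-before-boundary ([ω] χ) χ⊆φ) a b a<k+m with m≤n⇒m<n∨m≡n a<k+m
  ... | inj₁ 1+a<k+m = at (agree-before-boundary χ (χ⊆φ ∘ [ω]-in)) (suc a) 0 1+a<k+m
  ... | inj₂ 1+a≡k+m = subst (λ c → (ξ ⊨[ (c , 0) ] χ) ⇔ (η ⊨[ (c , 0) ] χ)) (sym 1+a≡k+m)
          (agree-at-boundary (χ⊆φ ([ω]-in here)) (at (agree-before-boundary χ (χ⊆φ ∘ [ω]-in)) k 0 (m<m+n k 0<m)))
  agree-before-boundary (α ∧' β) αβ⊆φ =
    ∧-rowEquiv (agree-before-boundary α (αβ⊆φ ∘ ∧ˡ)) (agree-before-boundary β (αβ⊆φ ∘ ∧ʳ))
  agree-before-boundary (α u β)  αβ⊆φ =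
    u-rowEquiv (agree-before-boundary α (αβ⊆φ ∘ uˡ)) (agree-before-boundary β (αβ⊆φ ∘ uʳ))
  agree-before-boundary (α U β) αβ⊆φ =
    until-rowEquiv (αβ⊆φ here) (agree-before-boundary α (αβ⊆φ ∘ Uˡ)) (agree-before-boundary β (αβ⊆φ ∘ Uʳ))

mainTheorem14 : (φ : Form) (ξ η : Model) (k m : ℕ) → 0 < m →
    SubEq φ (k , 0) ξ (k + m , 0) ξ →
    (∀ t₁ t₂ → (t₁ , t₂) <ₜ (k + m , 0) → ∀ p → ξ t₁ t₂ p ≡ η t₁ t₂ p) →
    (∀ s₁ s₂ → (k , 0) ≤ₜ (s₁ , s₂) → ∀ p → η s₁ s₂ p ≡ η (s₁ + m) s₂ p) →
    (∀ ψ θ → (ψ U θ) ∈Sub φ → ξ ⊨[ (k , 0) ] (ψ U θ) →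
      ∃[ r ] (((k , 0) ≤ₜ r) × (r <ₜ (k + m , 0)) × (ξ ⊨[ r ] θ))) →
    (∀ t → t <ₜ (k + m , 0) → SubEq φ t ξ t η) ×
    (∀ s₁ s₂ → (k , 0) ≤ₜ (s₁ , s₂) → SubEq φ (s₁ , s₂) η (s₁ + m , s₂) η)
mainTheorem14 φ ξ η k m 0<m recurs agree periodic witnessed =
    (λ (a , b) ab<boundary ψ ψ∈φ →
       at (agree-before-boundary ψ (∈Sub⇒⊆Sub ψ∈φ)) a b (<ₗ-rowStart⇒< (<ₜ⇒<ₗ ab<boundary)))
  , (λ s₁ s₂ k≤s ψ _ → at (periodic-rowEquiv per ψ) s₁ s₂ (≤ₜ⇒≤ k≤s))
  where
  per : Periodic η k m
  per a b p k≤a = periodic a b (≤⇒rowStart≤ₜ k≤a) p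

  open Agreement φ ξ η k m 0<m recurs (λ a b p a<k+m → agree a b (<ₗ⇒<ₜ (inj₁ a<k+m)) p) per witnessed
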